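{- Let $q\ge 8$ be an integer with $q\equiv 0$ or $q\equiv 1\pmod 4$, and let $\ell=\binom{q}{2}$. For every integer $k\ge 1$ and $n=(\ell+2)^k$, there exists a completely balanced edge-coloring of $K_n$ with $\ell+1$ colors that contains no rainbow $K_q$.
   Context: $K_n$ denotes the complete graph on $n$ vertices. An edge-coloring of $K_n$ using a set $C$ of $t$ colors, where $t$ divides $n-1$, is completely balanced if every vertex is incident to exactly $(n-1)/t$ edges of each color of $C$. A subgraph is rainbow if all its edges receive distinct colors. -}

module Defs where

open import Data.Nat using (ℕ; _*_; _∸_; _<_)
open import Data.Nat.Combinatorics using (_C_)
open import Data.Fin using (Fin; toℕ)
open import Data.Fin.Properties using (_≟_)
open import Data.List using (List; length; filter; allFin)
open import Data.Product using (_×_; Σ)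
open import Relation.Binary.PropositionalEquality using (_≡_; _≢_)
open import Relation.Nullary.Decidable using (_×-dec_; ¬?)
open import Function.Definitions using (Injective)

-- An edge-coloring of K_n with t colors: a symmetric function on pairs of
-- vertices (the value on the diagonal u = u is irrelevant, since K_n has no loops).
record EdgeColoring (n t : ℕ) : Set where
  field
    col  : Fin n → Fin n → Fin t
    symm : ∀ u v → col u v ≡ col v u
open EdgeColoring public

degIn : ∀ {n t} → EdgeColoring n t → Fin n → Fin t → ℕ
degIn {n} c v a =
  length (filter (λ u → ¬? (u ≟ v) ×-dec (col c v u ≟ a)) (allFin n))

-- completely balanced (with t ∣ n-1): every vertex is incident to exactly
-- (n-1)/t edges of each color, written without division as deg * t = n - 1.
CompletelyBalanced : ∀ {n t} → EdgeColoring n t → Set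
CompletelyBalanced {n} {t} c = ∀ v a → degIn c v a * t ≡ n ∸ 1

RainbowK : ∀ {n t} → EdgeColoring n t → (q : ℕ) → Set
RainbowK {n} c q =
  Σ (Fin q → Fin n) λ f → Injective _≡_ _≡_ f ×
    (∀ i j i' j' → toℕ i < toℕ j → toℕ i' < toℕ j' →
       col c (f i) (f j) ≡ col c (f i') (f j') → (i ≡ i') × (j ≡ j'))

-- Let ℓ = q C 2, which is even, and N = ℓ + 1.  Colour K_{N+1} on the vertex set ℤ/N ∪ {∞} by
-- giving {x, y} the colour x + y and {x, ∞} the colour 2x.  Since N is odd this is a
-- 1-factorisation, so every vertex sees each of the N colours exactly once.  A rainbow K_q
-- would need ℓ = N - 1 distinct colours.  If it contains ∞, its other q - 1 vertices form a
-- Sidon set of ℤ/N (the sums x + y with x = y allowed determine {x, y}), so their (q-1)(q-2)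
-- differences are distinct: too many for q ≥ 8.  Otherwise its q vertices form a weak Sidon
-- set; two of its q(q-1) differences can only agree when a vertex is the midpoint of two
-- others, and at most 2q ordered pairs are affected: again too many.
-- To reach n = (ℓ+2)^k, blow up: replace every vertex of φ by a copy of W and colour the edges
-- between two copies by the colour in φ of their indices.  Complete balance is preserved, and
-- a rainbow K_q of the blow-up either meets every copy at most once or lies inside one copy.
module Submission where

open import Defs
open import Data.Bool using (Bool; true; false; if_then_else_)
open import Data.Empty using (⊥-elim)
open import Data.Fin using (Fin; zero; suc; toℕ; _↑ˡ_; _↑ʳ_; combine; remQuot; punchIn; punchOut; _<?_)
open import Data.Fin.Properties
  using ( _≟_; <-cmp; <⇒≢; any?; toℕ-fromℕ<; toℕ-injective; toℕ<n; suc-injective; injective⇒≤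
        ; punchInᵢ≢i; punchIn-injective; punchIn-punchOut; remQuot-combine; combine-remQuot
        ; combine-injective; *↔×; +↔⊎; 2↔Bool )
open import Data.List using (length; filter; tabulate; _∷_; [])
open import Data.Nat using (ℕ; zero; suc; _+_; _*_; _∸_; _^_; _≤_; _<_; _%_; _/_; s≤s; z≤n; NonZero)
open import Data.Nat.Combinatorics using (_C_; nCk+nC[k+1]≡[n+1]C[k+1]; nC1≡n)
open import Data.Nat.DivMod
  using ( _mod_; %-distribˡ-+; %-distribˡ-*; m%n%n≡m%n; [m+n]%n≡m%n; [m+kn]%n≡m%n
        ; m<n⇒m%n≡m; m%n<n; m≡m%n+[m/n]*n )
open import Data.Nat.Properties
  using ( +-*-semiring; +-comm; +-assoc; *-comm; *-assoc; *-distribˡ-+; *-distribʳ-+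
        ; +-identityʳ; m∸n+n≡m; <⇒≤; <⇒≱; *-cancelˡ-≡; *-cancelˡ-≤; m≤m+n; +-monoʳ-≤
        ; m≤n⇒∃[o]m+o≡n; module ≤-Reasoning )
open import Algebra.Properties.Semiring.Sum +-*-semiring
  using (sum; sum-syntax; sum-remove; sum-cong-≗; sum-replicate-zero; *-distribˡ-sum)
open import Data.Nat.Tactic.RingSolver using (solve)
open import Data.Product using (Σ; ∃; _×_; _,_; proj₁; proj₂; swap; uncurry)
open import Data.Product.Function.NonDependent.Propositional using (_×-↔_)
open import Data.Product.Properties using (×-≡,≡←≡)
open import Data.Sum using (_⊎_; inj₁; inj₂; [_,_]′)
open import Data.Sum.Function.Propositional using (_⊎-↔_)
open import Data.Sum.Properties using (inj₁-injective; inj₂-injective)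
open import Function using (_∘_; _⇔_; Equivalence; mk⇔; _↔_; _↣_; Injection; mk↣)
open import Function.Construct.Composition using (_↣-∘_; _↔-∘_)
open import Function.Definitions using (Injective)
open import Function.Properties.Inverse using (↔⇒↣; ↔-sym; ↔-refl)
open import Relation.Binary using (tri<; tri≈; tri>)
open import Relation.Binary.PropositionalEquality
open import Relation.Nullary using (Dec; yes; no; does; ¬_)
open import Relation.Nullary.Decidable using (_×-dec_; ¬?; dec-true; dec-false)
open import Relation.Unary using (Pred; Decidable)

χ : ∀ {p} {P : Set p} → Dec P → ℕ
χ d = if does d then 1 else 0

χ-yes : ∀ {p} {P : Set p} → P → (d : Dec P) → χ d ≡ 1
χ-yes p (yes _) = refl
χ-yes p (no ¬p) = ⊥-elim (¬p p)

χ-no : ∀ {p} {P : Set p} → ¬ P → (d : Dec P) → χ d ≡ 0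
χ-no ¬p (yes p) = ⊥-elim (¬p p)
χ-no ¬p (no _)  = refl

χ-cong : ∀ {p q} {P : Set p} {Q : Set q} → P ⇔ Q → (d : Dec P) (e : Dec Q) → χ d ≡ χ e
χ-cong P⇔Q (yes p) (yes q) = refl
χ-cong P⇔Q (yes p) (no ¬q) = ⊥-elim (¬q (Equivalence.to P⇔Q p))
χ-cong P⇔Q (no ¬p) (yes q) = ⊥-elim (¬p (Equivalence.from P⇔Q q))
χ-cong P⇔Q (no ¬p) (no ¬q) = refl

count : ∀ {n p} {P : Pred (Fin n) p} → Decidable P → ℕ
count P? = sum (χ ∘ P?)

length-filter-tabulate : ∀ {a p} {A : Set a} {P : Pred A p} (P? : Decidable P) {n} (g : Fin n → A) →
                         length (filter P? (tabulate g)) ≡ count (P? ∘ g)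
length-filter-tabulate P? {zero}  g = refl
length-filter-tabulate P? {suc n} g with does (P? (g zero))
... | true  = cong suc (length-filter-tabulate P? (g ∘ suc))
... | false = length-filter-tabulate P? (g ∘ suc)

count-cong : ∀ {n p q} {P : Pred (Fin n) p} {Q : Pred (Fin n) q} (P? : Decidable P) (Q? : Decidable Q) →
             (∀ i → P i ⇔ Q i) → count P? ≡ count Q?
count-cong P? Q? P⇔Q = sum-cong-≗ (λ i → χ-cong (P⇔Q i) (P? i) (Q? i))

count-const : ∀ n {p} {P : Set p} (d : Dec P) → count {n} (λ _ → d) ≡ n * χ d
count-const zero    d = refl
count-const (suc n) d = cong (χ d +_) (count-const n d)

count-≡ : ∀ {n} (i : Fin n) → count (_≟ i) ≡ 1
count-≡ {suc n} i = begin
  count (_≟ i)                            ≡⟨ sum-remove {i = i} (χ ∘ (_≟ i)) ⟩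
  χ (i ≟ i) + count ((_≟ i) ∘ punchIn i)  ≡⟨ cong₂ _+_ (χ-yes refl (i ≟ i)) (sum-cong-≗ others) ⟩
  1 + sum {n} (λ _ → 0)                   ≡⟨ cong suc (sum-replicate-zero n) ⟩
  1                                       ∎
  where
  open ≡-Reasoning
  others : ∀ j → χ (punchIn i j ≟ i) ≡ 0
  others j = χ-no (punchInᵢ≢i i j) (punchIn i j ≟ i)

count-unique : ∀ {n p} {P : Pred (Fin n) p} (P? : Decidable P) {i} → P i → (∀ j → P j → j ≡ i) →
               count P? ≡ 1
count-unique P? {i} Pi unique =
  trans (count-cong P? (_≟ i) (λ j → mk⇔ (unique j) (λ { refl → Pi }))) (count-≡ i)

sum-↑ : ∀ m {n} (f : Fin (m + n) → ℕ) → sum f ≡ sum (f ∘ (_↑ˡ n)) + sum (f ∘ (m ↑ʳ_))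
sum-↑ zero    f = refl
sum-↑ (suc m) f = trans (cong (f zero +_) (sum-↑ m (f ∘ suc))) (sym (+-assoc (f zero) _ _))

sum-combine : ∀ m {n} (f : Fin (m * n) → ℕ) → sum f ≡ ∑[ i < m ] ∑[ j < n ] f (combine i j)
sum-combine zero        f = refl
sum-combine (suc m) {n} f =
  trans (sum-↑ n f) (cong (sum (f ∘ (_↑ˡ m * n)) +_) (sum-combine m (f ∘ (n ↑ʳ_))))

count-combine : ∀ m {n p} {P : Pred (Fin (m * n)) p} (P? : Decidable P) →
                count P? ≡ ∑[ i < m ] count (λ j → P? (combine i j))
count-combine m P? = sum-combine m (χ ∘ P?)

module _ {n t} (c : EdgeColoring n t) where

  incident? : (v : Fin n) (a : Fin t) → Decidable (λ u → u ≢ v × col c v u ≡ a)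
  incident? v a u = ¬? (u ≟ v) ×-dec (col c v u ≟ a)

  degIn≡count : ∀ v a → degIn c v a ≡ count (incident? v a)
  degIn≡count v a = length-filter-tabulate (incident? v a) (λ u → u)

count-incident : ∀ {n t} (c : EdgeColoring (suc n) t) v a →
                 count (incident? c v a) ≡ ∑[ j < n ] χ (col c v (punchIn v j) ≟ a)
count-incident {n} c v a = begin
  count (incident? c v a)
    ≡⟨ sum-remove {i = v} (χ ∘ incident? c v a) ⟩
  χ (incident? c v a v) + ∑[ j < n ] χ (incident? c v a (punchIn v j))
    ≡⟨ cong₂ _+_ (χ-no (λ (v≢v , _) → v≢v refl) (incident? c v a v)) (sum-cong-≗ others) ⟩
  ∑[ j < n ] χ (col c v (punchIn v j) ≟ a)
    ∎
  where
  open ≡-Reasoning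
  others : ∀ j → χ (incident? c v a (punchIn v j)) ≡ χ (col c v (punchIn v j) ≟ a)
  others j = χ-cong (mk⇔ proj₂ (punchInᵢ≢i v j ,_)) (incident? c v a (punchIn v j)) (col c v (punchIn v j) ≟ a)

SamePair : ∀ {q} → Fin q → Fin q → Fin q → Fin q → Set
SamePair i j i' j' = (i ≡ i' × j ≡ j') ⊎ (i ≡ j' × j ≡ i')

IsRainbow : ∀ {n t q} → EdgeColoring n t → (Fin q → Fin n) → Set
IsRainbow c f = ∀ i j i' j' → toℕ i < toℕ j → toℕ i' < toℕ j' →
                col c (f i) (f j) ≡ col c (f i') (f j') → i ≡ i' × j ≡ j'

rainbow-samePair : ∀ {n t q} (c : EdgeColoring n t) (f : Fin q → Fin n) → IsRainbow c f →
                   ∀ {i j i' j'} → i ≢ j → i' ≢ j' → col c (f i) (f j) ≡ col c (f i') (f j') → SamePair i j i' j'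
rainbow-samePair c f rainbow {i} {j} {i'} {j'} i≢j i'≢j' same with <-cmp i j | <-cmp i' j'
... | tri≈ _ i≡j _ | _              = ⊥-elim (i≢j i≡j)
... | _            | tri≈ _ i'≡j' _ = ⊥-elim (i'≢j' i'≡j')
... | tri< i<j _ _ | tri< i'<j' _ _ = inj₁ (rainbow i j i' j' i<j i'<j' same)
... | tri< i<j _ _ | tri> _ _ j'<i' =
  inj₂ (rainbow i j j' i' i<j j'<i' (trans same (symm c (f i') (f j'))))
... | tri> _ _ j<i | tri< i'<j' _ _ =
  inj₂ (swap (rainbow j i i' j' j<i i'<j' (trans (symm c (f j) (f i)) same)))
... | tri> _ _ j<i | tri> _ _ j'<i' =
  inj₁ (swap (rainbow j i j' i' j<i j'<i' (trans (symm c (f j) (f i)) (trans same (symm c (f i') (f j'))))))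

isRainbow-resp : ∀ {n n' t q} {c : EdgeColoring n t} {c' : EdgeColoring n' t} {f : Fin q → Fin n} {g : Fin q → Fin n'} →
                 (∀ {i j} → i ≢ j → col c' (g i) (g j) ≡ col c (f i) (f j)) → IsRainbow c f → IsRainbow c' g
isRainbow-resp same rainbow i j i' j' i<j i'<j' e =
  rainbow i j i' j' i<j i'<j' (trans (sym (same (<⇒≢ i<j))) (trans e (same (<⇒≢ i'<j'))))

-- Blow-ups

module _ {m M t} (φ : EdgeColoring m t) (W : EdgeColoring M t) where

  blockCol : Fin m × Fin M → Fin m × Fin M → Fin t
  blockCol (b , w) (b' , w') with b ≟ b'
  ... | yes _ = col W w w'
  ... | no  _ = col φ b b'

  blockCol-inside : ∀ {b b'} w w' → b ≡ b' → blockCol (b , w) (b' , w') ≡ col W w w'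
  blockCol-inside {b} {b'} w w' b≡b' with b ≟ b'
  ... | yes _    = refl
  ... | no  b≢b' = ⊥-elim (b≢b' b≡b')

  blockCol-across : ∀ {b b'} w w' → b ≢ b' → blockCol (b , w) (b' , w') ≡ col φ b b'
  blockCol-across {b} {b'} w w' b≢b' with b ≟ b'
  ... | yes b≡b' = ⊥-elim (b≢b' b≡b')
  ... | no  _    = refl

  blockCol-sym : ∀ x y → blockCol x y ≡ blockCol y x
  blockCol-sym (b , w) (b' , w') with b ≟ b' | b' ≟ b
  ... | yes _    | yes _    = symm W w w'
  ... | yes b≡b' | no  b'≢b = ⊥-elim (b'≢b (sym b≡b'))
  ... | no  b≢b' | yes b'≡b = ⊥-elim (b≢b' (sym b'≡b))
  ... | no  _    | no  _    = symm φ b b'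

  blowUp : EdgeColoring (m * M) t
  blowUp = record
    { col  = λ x y → blockCol (remQuot M x) (remQuot M y)
    ; symm = λ x y → blockCol-sym (remQuot M x) (remQuot M y)
    }

  block : Fin (m * M) → Fin m
  block x = proj₁ (remQuot {m} M x)

  pos : Fin (m * M) → Fin M
  pos x = proj₂ (remQuot {m} M x)

  blowUp-inside : ∀ {x y} → block x ≡ block y → col blowUp x y ≡ col W (pos x) (pos y)
  blowUp-inside = blockCol-inside _ _

  blowUp-across : ∀ {x y} → block x ≢ block y → col blowUp x y ≡ col φ (block x) (block y)
  blowUp-across = blockCol-across _ _

  col-blowUp-combine : ∀ b w b' w' → col blowUp (combine b w) (combine b' w') ≡ blockCol (b , w) (b' , w')
  col-blowUp-combine b w b' w' = cong₂ blockCol (remQuot-combine b w) (remQuot-combine b' w')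

  incident-inside : ∀ b w a w' →
    (combine b w' ≢ combine b w × col blowUp (combine b w) (combine b w') ≡ a) ⇔ (w' ≢ w × col W w w' ≡ a)
  incident-inside b w a w' = mk⇔
    (λ (≢w , ≡a) → (≢w ∘ cong (combine b)) , trans (sym colW) ≡a)
    (λ (≢w , ≡a) → (≢w ∘ proj₂ ∘ combine-injective b w' b w) , trans colW ≡a)
    where colW = trans (col-blowUp-combine b w b w') (blockCol-inside {b} w w' refl)

  incident-across : ∀ {b b'} w a w' → b ≢ b' →
    (combine b' w' ≢ combine b w × col blowUp (combine b w) (combine b' w') ≡ a) ⇔ (col φ b b' ≡ a)
  incident-across {b} {b'} w a w' b≢b' = mk⇔
    (λ (_ , ≡a) → trans (sym colφ) ≡a)
    (λ ≡a → (b≢b' ∘ sym ∘ proj₁ ∘ combine-injective b' w' b w) , trans colφ ≡a)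
    where colφ = trans (col-blowUp-combine b w b' w') (blockCol-across w w' b≢b')

  -- Two vertices in one block and a third outside it would span two edges of the same colour.
  blowUp-rainbowFree : ∀ {q} → ¬ RainbowK φ q → ¬ RainbowK W q → ¬ RainbowK blowUp q
  blowUp-rainbowFree {q} no-φ no-W (f , f-inj , rainbow)
    with any? (λ i → any? (λ i' → ¬? (i ≟ i') ×-dec (block (f i) ≟ block (f i'))))
  ... | no no-collision = no-φ (block ∘ f , block-injective , isRainbow-resp {c = blowUp} {c' = φ} {f = f} across rainbow)
    where
    block-injective : Injective _≡_ _≡_ (block ∘ f)
    block-injective {i} {i'} same with i ≟ i'
    ... | yes i≡i' = i≡i'
    ... | no  i≢i' = ⊥-elim (no-collision (i , i' , i≢i' , same))
    across : ∀ {i j} → i ≢ j → col φ (block (f i)) (block (f j)) ≡ col blowUp (f i) (f j)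
    across i≢j = sym (blowUp-across (i≢j ∘ block-injective))
  ... | yes (i , i' , i≢i' , same) with any? (λ j → ¬? (block (f j) ≟ block (f i)))
  ...   | yes (j , outside) = [ i≢i' ∘ proj₁ , outside ∘ cong (block ∘ f) ∘ sym ∘ proj₁ ]′
            (rainbow-samePair blowUp f rainbow (outside ∘ sym ∘ cong (block ∘ f)) i'≢j same-colour)
    where
    i'≢j : i' ≢ j
    i'≢j i'≡j = outside (trans (cong (block ∘ f) (sym i'≡j)) (sym same))
    same-colour : col blowUp (f i) (f j) ≡ col blowUp (f i') (f j)
    same-colour = begin
      col blowUp (f i) (f j)              ≡⟨ blowUp-across (outside ∘ sym) ⟩
      col φ (block (f i)) (block (f j))   ≡⟨ cong (λ b → col φ b (block (f j))) same ⟩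
      col φ (block (f i')) (block (f j))  ≡⟨ blowUp-across (outside ∘ sym ∘ trans same) ⟨
      col blowUp (f i') (f j)             ∎
      where open ≡-Reasoning
  ...   | no  none-outside = no-W (pos ∘ f , pos-injective , isRainbow-resp {c = blowUp} {c' = W} {f = f} inside rainbow)
    where
    one-block : ∀ j → block (f j) ≡ block (f i)
    one-block j with block (f j) ≟ block (f i)
    ... | yes e       = e
    ... | no  outside = ⊥-elim (none-outside (j , outside))
    pos-injective : Injective _≡_ _≡_ (pos ∘ f)
    pos-injective {j} {j'} e = f-inj (begin
      f j                                  ≡⟨ combine-remQuot {m} M (f j) ⟨
      combine (block (f j)) (pos (f j))    ≡⟨ cong₂ combine (trans (one-block j) (sym (one-block j'))) e ⟩
      combine (block (f j')) (pos (f j'))  ≡⟨ combine-remQuot {m} M (f j') ⟩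
      f j'                                 ∎)
      where open ≡-Reasoning
    inside : ∀ {j j'} → j ≢ j' → col W (pos (f j)) (pos (f j')) ≡ col blowUp (f j) (f j')
    inside {j} {j'} _ = sym (blowUp-inside (trans (one-block j) (sym (one-block j'))))

-- The vertex (b , w) sees its own block through W, and all of block b' in the single colour φ b b'.
degree-blowUp : ∀ {m M t} (φ : EdgeColoring m t) (W : EdgeColoring M t) b w a →
  count (incident? (blowUp φ W) (combine b w) a) ≡ count (incident? W w a) + M * count (incident? φ b a)
degree-blowUp {suc m} {M} φ W b w a = begin
  count (incident? B v a)
    ≡⟨ count-combine (suc m) (incident? B v a) ⟩
  ∑[ b' < suc m ] count (λ w' → incident? B v a (combine b' w'))
    ≡⟨ sum-remove {i = b} (λ b' → count (λ w' → incident? B v a (combine b' w'))) ⟩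
  count (λ w' → incident? B v a (combine b w')) + ∑[ j < m ] count (λ w' → incident? B v a (combine (punchIn b j) w'))
    ≡⟨ cong₂ _+_ own-block (sum-cong-≗ other-block) ⟩
  count (incident? W w a) + ∑[ j < m ] (M * χ (col φ b (punchIn b j) ≟ a))
    ≡⟨ cong (count (incident? W w a) +_) (*-distribˡ-sum M (λ j → χ (col φ b (punchIn b j) ≟ a))) ⟨
  count (incident? W w a) + M * ∑[ j < m ] χ (col φ b (punchIn b j) ≟ a)
    ≡⟨ cong (λ d → count (incident? W w a) + M * d) (count-incident φ b a) ⟨
  count (incident? W w a) + M * count (incident? φ b a)
    ∎
  where
  open ≡-Reasoning
  B = blowUp φ W
  v = combine b w
  own-block : count (λ w' → incident? B v a (combine b w')) ≡ count (incident? W w a)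
  own-block = count-cong (λ w' → incident? B v a (combine b w')) (incident? W w a) (incident-inside φ W b w a)
  other-block : ∀ j → count (λ w' → incident? B v a (combine (punchIn b j) w')) ≡ M * χ (col φ b (punchIn b j) ≟ a)
  other-block j = trans
    (count-cong (λ w' → incident? B v a (combine (punchIn b j) w')) (λ _ → col φ b (punchIn b j) ≟ a)
                (λ w' → incident-across φ W w a w' (punchInᵢ≢i b j ∘ sym)))
    (count-const M (col φ b (punchIn b j) ≟ a))

blowUp-balanced : ∀ {m M t} (φ : EdgeColoring m t) (W : EdgeColoring M t) →
  CompletelyBalanced φ → CompletelyBalanced W → CompletelyBalanced (blowUp φ W)
blowUp-balanced {zero} φ W φ-bal W-bal () a
blowUp-balanced {suc m} {zero} φ W φ-bal W-bal v a with () ← proj₂ (remQuot {suc m} zero v)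
blowUp-balanced {suc m} {suc M} {t} φ W φ-bal W-bal v a = begin
  degIn B v a * t
    ≡⟨ cong (λ u → degIn B u a * t) (combine-remQuot {suc m} (suc M) v) ⟨
  degIn B (combine b w) a * t
    ≡⟨ cong (_* t) (trans (degIn≡count B (combine b w) a) (degree-blowUp φ W b w a)) ⟩
  (count (incident? W w a) + suc M * count (incident? φ b a)) * t
    ≡⟨ *-distribʳ-+ t (count (incident? W w a)) (suc M * count (incident? φ b a)) ⟩
  count (incident? W w a) * t + suc M * count (incident? φ b a) * t
    ≡⟨ cong (count (incident? W w a) * t +_) (*-assoc (suc M) (count (incident? φ b a)) t) ⟩
  count (incident? W w a) * t + suc M * (count (incident? φ b a) * t)
    ≡⟨ cong₂ (λ x y → x + suc M * y) (count-balanced W W-bal w a) (count-balanced φ φ-bal b a) ⟩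
  M + suc M * m
    ≡⟨ cong (M +_) (*-comm (suc M) m) ⟩
  suc m * suc M ∸ 1
    ∎
  where
  open ≡-Reasoning
  B = blowUp φ W
  b = proj₁ (remQuot {suc m} (suc M) v)
  w = proj₂ (remQuot {suc m} (suc M) v)
  count-balanced : ∀ {n} (c : EdgeColoring (suc n) t) → CompletelyBalanced c → ∀ u a → count (incident? c u a) * t ≡ n
  count-balanced c c-bal u a = trans (cong (_* t) (sym (degIn≡count c u a))) (c-bal u a)

pointColoring : ∀ t → EdgeColoring 1 (suc t)
pointColoring t = record { col = λ _ _ → zero ; symm = λ _ _ → refl }

pointColoring-balanced : ∀ t → CompletelyBalanced (pointColoring t)
pointColoring-balanced t zero a = refl

pointColoring-rainbowFree : ∀ t {q} → 2 ≤ q → ¬ RainbowK (pointColoring t) q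
pointColoring-rainbowFree t 2≤q (f , f-inj , _) = <⇒≱ 2≤q (injective⇒≤ f-inj)

blowUp-power : ∀ {m t q} (φ : EdgeColoring m (suc t)) → 2 ≤ q → CompletelyBalanced φ → ¬ RainbowK φ q →
               ∀ k → Σ (EdgeColoring (m ^ k) (suc t)) λ c → CompletelyBalanced c × ¬ RainbowK c q
blowUp-power {t = t} φ 2≤q φ-bal φ-free zero =
  pointColoring t , pointColoring-balanced t , pointColoring-rainbowFree t 2≤q
blowUp-power φ 2≤q φ-bal φ-free (suc k) with blowUp-power φ 2≤q φ-bal φ-free k
... | W , W-bal , W-free = blowUp φ W , blowUp-balanced φ W φ-bal W-bal , blowUp-rainbowFree φ W φ-free W-free

module _ {N : ℕ} .{{_ : NonZero N}} where

  [m%n+o]%n≡[m+o]%n : ∀ m o → (m % N + o) % N ≡ (m + o) % N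
  [m%n+o]%n≡[m+o]%n m o = begin
    (m % N + o) % N          ≡⟨ %-distribˡ-+ (m % N) o N ⟩
    (m % N % N + o % N) % N  ≡⟨ cong (λ k → (k + o % N) % N) (m%n%n≡m%n m N) ⟩
    (m % N + o % N) % N      ≡⟨ %-distribˡ-+ m o N ⟨
    (m + o) % N              ∎
    where open ≡-Reasoning

  [m+o%n]%n≡[m+o]%n : ∀ m o → (m + o % N) % N ≡ (m + o) % N
  [m+o%n]%n≡[m+o]%n m o = begin
    (m + o % N) % N  ≡⟨ cong (_% N) (+-comm m (o % N)) ⟩
    (o % N + m) % N  ≡⟨ [m%n+o]%n≡[m+o]%n o m ⟩
    (o + m) % N      ≡⟨ cong (_% N) (+-comm o m) ⟩
    (m + o) % N      ∎
    where open ≡-Reasoning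

  [m*[o%n]]%n≡[m*o]%n : ∀ m o → (m * (o % N)) % N ≡ (m * o) % N
  [m*[o%n]]%n≡[m*o]%n m o = begin
    (m * (o % N)) % N          ≡⟨ %-distribˡ-* m (o % N) N ⟩
    (m % N * (o % N % N)) % N  ≡⟨ cong (λ k → (m % N * k) % N) (m%n%n≡m%n o N) ⟩
    (m % N * (o % N)) % N      ≡⟨ %-distribˡ-* m o N ⟨
    (m * o) % N                ∎
    where open ≡-Reasoning

module Modular (N : ℕ) .{{_ : NonZero N}} where

  infixl 6 _⊕_
  infix  8 ⊝_

  _⊕_ : Fin N → Fin N → Fin N
  x ⊕ y = (toℕ x + toℕ y) mod N

  ⊝_ : Fin N → Fin N
  ⊝ x = (N ∸ toℕ x) mod N

  toℕ-mod : ∀ m → toℕ (m mod N) ≡ m % N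
  toℕ-mod m = toℕ-fromℕ< (m%n<n m N)

  mod-cong : ∀ {m o} → m % N ≡ o % N → m mod N ≡ o mod N
  mod-cong e = toℕ-injective (trans (toℕ-mod _) (trans e (sym (toℕ-mod _))))

  %≡toℕ⇒mod≡ : ∀ m (x : Fin N) → m % N ≡ toℕ x → m mod N ≡ x
  %≡toℕ⇒mod≡ m x e = toℕ-injective (trans (toℕ-mod m) e)

  ⊕-comm : ∀ x y → x ⊕ y ≡ y ⊕ x
  ⊕-comm x y = cong (_mod N) (+-comm (toℕ x) (toℕ y))

  ⊕-assoc : ∀ x y z → x ⊕ y ⊕ z ≡ x ⊕ (y ⊕ z)
  ⊕-assoc x y z = mod-cong (begin
    (toℕ (x ⊕ y) + toℕ z) % N          ≡⟨ cong (λ k → (k + toℕ z) % N) (toℕ-mod (toℕ x + toℕ y)) ⟩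
    ((toℕ x + toℕ y) % N + toℕ z) % N  ≡⟨ [m%n+o]%n≡[m+o]%n (toℕ x + toℕ y) (toℕ z) ⟩
    (toℕ x + toℕ y + toℕ z) % N        ≡⟨ cong (_% N) (+-assoc (toℕ x) (toℕ y) (toℕ z)) ⟩
    (toℕ x + (toℕ y + toℕ z)) % N      ≡⟨ [m+o%n]%n≡[m+o]%n (toℕ x) (toℕ y + toℕ z) ⟨
    (toℕ x + (toℕ y + toℕ z) % N) % N  ≡⟨ cong (λ k → (toℕ x + k) % N) (toℕ-mod (toℕ y + toℕ z)) ⟨
    (toℕ x + toℕ (y ⊕ z)) % N          ∎)
    where open ≡-Reasoning

  ⊝-cancelˡ : ∀ x y → ⊝ x ⊕ (x ⊕ y) ≡ y
  ⊝-cancelˡ x y = %≡toℕ⇒mod≡ (toℕ (⊝ x) + toℕ (x ⊕ y)) y (begin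
    (toℕ (⊝ x) + toℕ (x ⊕ y)) % N                ≡⟨ cong₂ (λ k l → (k + l) % N) (toℕ-mod (N ∸ toℕ x)) (toℕ-mod (toℕ x + toℕ y)) ⟩
    ((N ∸ toℕ x) % N + (toℕ x + toℕ y) % N) % N  ≡⟨ %-distribˡ-+ (N ∸ toℕ x) (toℕ x + toℕ y) N ⟨
    (N ∸ toℕ x + (toℕ x + toℕ y)) % N            ≡⟨ cong (_% N) (+-assoc (N ∸ toℕ x) (toℕ x) (toℕ y)) ⟨
    (N ∸ toℕ x + toℕ x + toℕ y) % N              ≡⟨ cong (λ k → (k + toℕ y) % N) (m∸n+n≡m (<⇒≤ (toℕ<n x))) ⟩
    (N + toℕ y) % N                              ≡⟨ cong (_% N) (+-comm N (toℕ y)) ⟩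
    (toℕ y + N) % N                              ≡⟨ [m+n]%n≡m%n (toℕ y) N ⟩
    toℕ y % N                                    ≡⟨ m<n⇒m%n≡m (toℕ<n y) ⟩
    toℕ y                                        ∎)
    where open ≡-Reasoning

  ⊕-cancelˡ : ∀ a {x y} → a ⊕ x ≡ a ⊕ y → x ≡ y
  ⊕-cancelˡ a {x} {y} e = begin
    x              ≡⟨ ⊝-cancelˡ a x ⟨
    ⊝ a ⊕ (a ⊕ x)  ≡⟨ cong (⊝ a ⊕_) e ⟩
    ⊝ a ⊕ (a ⊕ y)  ≡⟨ ⊝-cancelˡ a y ⟩
    y              ∎
    where open ≡-Reasoning

  ⊕-⊝-cancelˡ : ∀ x y → x ⊕ (⊝ x ⊕ y) ≡ y
  ⊕-⊝-cancelˡ x y = ⊕-cancelˡ (⊝ x) (⊝-cancelˡ x (⊝ x ⊕ y))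

  differences-equal⇒sums-equal : ∀ {x y x' y'} → ⊝ x ⊕ y ≡ ⊝ x' ⊕ y' → y ⊕ x' ≡ y' ⊕ x
  differences-equal⇒sums-equal {x} {y} {x'} {y'} e = begin
    y ⊕ x'              ≡⟨ cong (_⊕ x') (⊕-⊝-cancelˡ x y) ⟨
    x ⊕ (⊝ x ⊕ y) ⊕ x'  ≡⟨ cong (λ d → x ⊕ d ⊕ x') e ⟩
    x ⊕ d ⊕ x'          ≡⟨ ⊕-comm (x ⊕ d) x' ⟩
    x' ⊕ (x ⊕ d)        ≡⟨ cong (x' ⊕_) (⊕-comm x d) ⟩
    x' ⊕ (d ⊕ x)        ≡⟨ ⊕-assoc x' d x ⟨
    x' ⊕ d ⊕ x          ≡⟨ cong (_⊕ x) (⊕-⊝-cancelˡ x' y') ⟩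
    y' ⊕ x              ∎
    where
    open ≡-Reasoning
    d = ⊝ x' ⊕ y'

module Halving (h : ℕ) where

  open Modular (suc (2 * h))

  -- suc h is the inverse of 2 modulo 2h + 1.
  half : Fin (suc (2 * h)) → Fin (suc (2 * h))
  half y = (suc h * toℕ y) mod suc (2 * h)

  private
    N : ℕ
    N = suc (2 * h)

    double-suc-h : ∀ m → suc h * m + suc h * m ≡ m + m * suc (2 * h)
    double-suc-h m = solve (h ∷ m ∷ [])

    double-suc-h-% : ∀ m → (suc h * m + suc h * m) % N ≡ m % N
    double-suc-h-% m = begin
      (suc h * m + suc h * m) % N  ≡⟨ cong (_% N) (double-suc-h m) ⟩
      (m + m * N) % N              ≡⟨ [m+kn]%n≡m%n m m N ⟩
      m % N                        ∎
      where open ≡-Reasoning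

  ⊕-half : ∀ y → half y ⊕ half y ≡ y
  ⊕-half y = %≡toℕ⇒mod≡ (toℕ (half y) + toℕ (half y)) y (begin
    (toℕ (half y) + toℕ (half y)) % N                ≡⟨ cong (λ k → (k + k) % N) (toℕ-mod (suc h * toℕ y)) ⟩
    ((suc h * toℕ y) % N + (suc h * toℕ y) % N) % N  ≡⟨ %-distribˡ-+ (suc h * toℕ y) (suc h * toℕ y) N ⟨
    (suc h * toℕ y + suc h * toℕ y) % N              ≡⟨ double-suc-h-% (toℕ y) ⟩
    toℕ y % N                                        ≡⟨ m<n⇒m%n≡m (toℕ<n y) ⟩
    toℕ y                                            ∎)
    where open ≡-Reasoning

  half-⊕ : ∀ x → half (x ⊕ x) ≡ x
  half-⊕ x = %≡toℕ⇒mod≡ (suc h * toℕ (x ⊕ x)) x (begin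
    (suc h * toℕ (x ⊕ x)) % N            ≡⟨ cong (λ k → (suc h * k) % N) (toℕ-mod (toℕ x + toℕ x)) ⟩
    (suc h * ((toℕ x + toℕ x) % N)) % N  ≡⟨ [m*[o%n]]%n≡[m*o]%n (suc h) (toℕ x + toℕ x) ⟩
    (suc h * (toℕ x + toℕ x)) % N        ≡⟨ cong (_% N) (*-distribˡ-+ (suc h) (toℕ x) (toℕ x)) ⟩
    (suc h * toℕ x + suc h * toℕ x) % N  ≡⟨ double-suc-h-% (toℕ x) ⟩
    toℕ x % N                            ≡⟨ m<n⇒m%n≡m (toℕ<n x) ⟩
    toℕ x                                ∎)
    where open ≡-Reasoning

  ⊕-double-injective : ∀ {x y} → x ⊕ x ≡ y ⊕ y → x ≡ y
  ⊕-double-injective {x} {y} e = trans (sym (half-⊕ x)) (trans (cong half e) (half-⊕ y))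

-- Sidon sets

↣⇒≤ : ∀ {m n} → Fin m ↣ Fin n → m ≤ n
↣⇒≤ f = injective⇒≤ (Injection.injective f)

does-<?-flip : ∀ {q} {j z : Fin q} → j ≢ z → does (j <? z) ≢ does (z <? j)
does-<?-flip {j = j} {z} j≢z with <-cmp j z
... | tri< j<z _ z≮j rewrite dec-true (j <? z) j<z | dec-false (z <? j) z≮j = λ ()
... | tri≈ _ j≡z _ = ⊥-elim (j≢z j≡z)
... | tri> j≮z _ z<j rewrite dec-false (j <? z) j≮z | dec-true (z <? j) z<j = λ ()

module _ {N : ℕ} .{{_ : NonZero N}} where

  open Modular N

  Sidon : ∀ {p} → (Fin p → Fin N) → Set
  Sidon g = ∀ i j i' j' → g i ⊕ g j ≡ g i' ⊕ g j' → SamePair i j i' j'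

  WeakSidon : ∀ {p} → (Fin p → Fin N) → Set
  WeakSidon g = ∀ {i j i' j'} → i ≢ j → i' ≢ j' → g i ⊕ g j ≡ g i' ⊕ g j' → SamePair i j i' j'

  sidon-size : ∀ {p} (g : Fin (suc p) → Fin N) → Sidon g → suc p * p ≤ N
  sidon-size {p} g sidon = ↣⇒≤ (mk↣ difference-injective ↣-∘ ↔⇒↣ *↔×)
    where
    difference : Fin (suc p) × Fin p → Fin N
    difference (i , k) = ⊝ g i ⊕ g (punchIn i k)
    difference-injective : Injective _≡_ _≡_ difference
    difference-injective {i , k} {i' , k'} e
      with sidon (punchIn i k) i' (punchIn i' k') i (differences-equal⇒sums-equal e)
    ... | inj₁ (j≡j' , refl) = cong (i ,_) (punchIn-injective i k k' j≡j')
    ... | inj₂ (j≡i , _)     = ⊥-elim (punchInᵢ≢i i k j≡i)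

  weakSidon-size : ∀ {p} (g : Fin (suc p) → Fin N) → Injective _≡_ _≡_ g →
                   (∀ {x y} → x ⊕ x ≡ y ⊕ y → x ≡ y) → WeakSidon g → suc p * p ≤ N + suc p * 2
  weakSidon-size {p} g g-inj ⊕-double-inj sidon =
    ↣⇒≤ ((↔⇒↣ (↔-sym codes↔) ↣-∘ mk↣ code-injective) ↣-∘ ↔⇒↣ *↔×)
    where
    Q = suc p

    Midpoint : Fin Q → Fin Q → Fin Q → Set
    Midpoint i j z = z ≢ i × z ≢ j × g z ⊕ g j ≡ g i ⊕ g i

    midpoint? : ∀ i j → Dec (∃ (Midpoint i j))
    midpoint? i j = any? (λ z → ¬? (z ≟ i) ×-dec ¬? (z ≟ j) ×-dec (g z ⊕ g j ≟ g i ⊕ g i))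

    codes↔ : Fin (N + Q * 2) ↔ (Fin N ⊎ (Fin Q × Bool))
    codes↔ = (↔-refl ⊎-↔ ((↔-refl ×-↔ 2↔Bool) ↔-∘ *↔×)) ↔-∘ +↔⊎

    -- The difference ⊝ g i ⊕ g j can only collide with another one when g i is the midpoint
    -- of g j and some g z; such a pair is coded instead by i and the order of j and z.
    code′ : ∀ i j → Dec (∃ (Midpoint i j)) → Fin N ⊎ (Fin Q × Bool)
    code′ i j (yes (z , _)) = inj₂ (i , does (j <? z))
    code′ i j (no _)        = inj₁ (⊝ g i ⊕ g j)

    code : Fin Q × Fin p → Fin N ⊎ (Fin Q × Bool)
    code (i , k) = code′ i (punchIn i k) (midpoint? i (punchIn i k))

    code′-injective : ∀ {i j i' j'} → i ≢ j → i' ≢ j' →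
                      (d : Dec (∃ (Midpoint i j))) (d' : Dec (∃ (Midpoint i' j'))) →
                      code′ i j d ≡ code′ i' j' d' → i ≡ i' × j ≡ j'
    code′-injective {i} {j} {_} {j'} i≢j i'≢j' (yes (z , _ , z≢j , mid)) (yes (z' , _ , z'≢j' , mid')) e
      with ×-≡,≡←≡ (inj₂-injective e)
    ... | refl , order with sidon z≢j z'≢j' (trans mid (sym mid'))
    ...   | inj₁ (_ , j≡j')    = refl , j≡j'
    ...   | inj₂ (z≡j' , j≡z') = ⊥-elim (does-<?-flip (z≢j ∘ sym)
              (trans order (cong₂ (λ a b → does (a <? b)) (sym z≡j') (sym j≡z'))))
    code′-injective i≢j i'≢j' (yes _) (no _) ()
    code′-injective i≢j i'≢j' (no _) (yes _) ()
    code′-injective {i} {j} {i'} {j'} i≢j i'≢j' (no no-mid) (no no-mid') e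
      with differences-equal⇒sums-equal (inj₁-injective e) | j ≟ i' | i ≟ j'
    ... | sums | yes refl | yes refl = ⊥-elim (i≢j (sym (g-inj (⊕-double-inj sums))))
    ... | sums | yes refl | no  i≢j' = ⊥-elim (no-mid' (i , i≢j , i≢j' , trans (⊕-comm (g i) (g j')) (sym sums)))
    ... | sums | no  j≢i' | yes refl = ⊥-elim (no-mid (i' , i'≢j' , j≢i' ∘ sym , trans (⊕-comm (g i') (g j)) sums))
    ... | sums | no  j≢i' | no  i≢j' with sidon j≢i' (i≢j' ∘ sym) sums
    ...   | inj₁ (j≡j' , i'≡i) = sym i'≡i , j≡j'
    ...   | inj₂ (j≡i , _)     = ⊥-elim (i≢j (sym j≡i))

    code-injective : Injective _≡_ _≡_ code
    code-injective {i , k} {i' , k'} e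
      with code′-injective (punchInᵢ≢i i k ∘ sym) (punchInᵢ≢i i' k' ∘ sym)
             (midpoint? i (punchIn i k)) (midpoint? i' (punchIn i' k')) e
    ... | refl , j≡j' = cong (i ,_) (punchIn-injective i k k' j≡j')

-- The sum colouring

module SumColoring (h : ℕ) where

  N : ℕ
  N = suc (2 * h)

  open Modular N
  open Halving h

  -- Vertex zero is ∞ and vertex suc x is x ∈ ℤ/N; the colour on the diagonal is irrelevant.
  sumCol : Fin (suc N) → Fin (suc N) → Fin N
  sumCol zero    zero    = zero
  sumCol zero    (suc y) = y ⊕ y
  sumCol (suc x) zero    = x ⊕ x
  sumCol (suc x) (suc y) = x ⊕ y

  sumCol-sym : ∀ u v → sumCol u v ≡ sumCol v u
  sumCol-sym zero    zero    = refl
  sumCol-sym zero    (suc y) = refl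
  sumCol-sym (suc x) zero    = refl
  sumCol-sym (suc x) (suc y) = ⊕-comm x y

  sumColoring : EdgeColoring (suc N) N
  sumColoring = record { col = sumCol ; symm = sumCol-sym }

  degree-one : ∀ v a → count (incident? sumColoring v a) ≡ 1
  degree-one zero a = count-unique (incident? sumColoring zero a) ((λ ()) , ⊕-half a) unique
    where
    unique : ∀ u → u ≢ zero × sumCol zero u ≡ a → u ≡ suc (half a)
    unique zero    (0≢0 , _)   = ⊥-elim (0≢0 refl)
    unique (suc y) (_ , y⊕y≡a) = cong suc (trans (sym (half-⊕ y)) (cong half y⊕y≡a))
  degree-one (suc x) a = degree-finite (x ⊕ x ≟ a)
    where
    degree-finite : Dec (x ⊕ x ≡ a) → count (incident? sumColoring (suc x) a) ≡ 1
    degree-finite (yes x⊕x≡a) = count-unique (incident? sumColoring (suc x) a) ((λ ()) , x⊕x≡a) unique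
      where
      unique : ∀ u → u ≢ suc x × sumCol (suc x) u ≡ a → u ≡ zero
      unique zero    _             = refl
      unique (suc y) (y≢x , x⊕y≡a) = ⊥-elim (y≢x (cong suc (⊕-cancelˡ x (trans x⊕y≡a (sym x⊕x≡a)))))
    degree-finite (no x⊕x≢a) = count-unique (incident? sumColoring (suc x) a) (other≢x , ⊕-⊝-cancelˡ x a) unique
      where
      other≢x : suc (⊝ x ⊕ a) ≢ suc x
      other≢x e = x⊕x≢a (trans (cong (x ⊕_) (sym (suc-injective e))) (⊕-⊝-cancelˡ x a))
      unique : ∀ u → u ≢ suc x × sumCol (suc x) u ≡ a → u ≡ suc (⊝ x ⊕ a)
      unique zero    (_ , x⊕x≡a) = ⊥-elim (x⊕x≢a x⊕x≡a)
      unique (suc y) (_ , x⊕y≡a) = cong suc (⊕-cancelˡ x (trans x⊕y≡a (sym (⊕-⊝-cancelˡ x a))))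

  sumColoring-balanced : CompletelyBalanced sumColoring
  sumColoring-balanced v a = begin
    degIn sumColoring v a * N  ≡⟨ cong (_* N) (trans (degIn≡count sumColoring v a) (degree-one v a)) ⟩
    1 * N                      ≡⟨ +-identityʳ N ⟩
    N                          ∎
    where open ≡-Reasoning

  module _ {p} {f : Fin (suc (suc p)) → Fin (suc N)} (f-inj : Injective _≡_ _≡_ f)
           (rainbow : IsRainbow sumColoring f) where

    through-∞ : ∀ i₀ → f i₀ ≡ zero → suc p * p ≤ N
    through-∞ i₀ fi₀≡∞ = sidon-size g sidon
      where
      vertex : Fin (suc p) → Fin (suc (suc p))
      vertex = punchIn i₀

      finite : ∀ k → zero ≢ f (vertex k)
      finite k e = punchInᵢ≢i i₀ k (f-inj (trans (sym e) (sym fi₀≡∞)))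

      g : Fin (suc p) → Fin N
      g k = punchOut (finite k)

      f-vertex : ∀ k → f (vertex k) ≡ suc (g k)
      f-vertex k = sym (punchIn-punchOut (finite k))

      -- The other end of an edge at vertex k of colour g k ⊕ g l: vertex l, or ∞ when l = k.
      partner : Fin (suc p) → Fin (suc p) → Fin (suc (suc p))
      partner k l with k ≟ l
      ... | yes _ = i₀
      ... | no  _ = vertex l

      partner-colour : ∀ k l → sumCol (f (vertex k)) (f (partner k l)) ≡ g k ⊕ g l
      partner-colour k l with k ≟ l
      ... | yes refl = cong₂ sumCol (f-vertex k) fi₀≡∞
      ... | no  _    = cong₂ sumCol (f-vertex k) (f-vertex l)

      vertex≢partner : ∀ k l → vertex k ≢ partner k l
      vertex≢partner k l with k ≟ l
      ... | yes _   = punchInᵢ≢i i₀ k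
      ... | no  k≢l = k≢l ∘ punchIn-injective i₀ k l

      vertex≡partner⇒≡ : ∀ {k k' l'} → vertex k ≡ partner k' l' → k ≡ l'
      vertex≡partner⇒≡ {k} {k'} {l'} e with k' ≟ l'
      ... | yes _ = ⊥-elim (punchInᵢ≢i i₀ k e)
      ... | no  _ = punchIn-injective i₀ k l' e

      partner-injective : ∀ {k l l'} → partner k l ≡ partner k l' → l ≡ l'
      partner-injective {k} {l} {l'} e with k ≟ l | k ≟ l'
      ... | yes refl | yes refl = refl
      ... | yes _    | no  _    = ⊥-elim (punchInᵢ≢i i₀ l' (sym e))
      ... | no  _    | yes _    = ⊥-elim (punchInᵢ≢i i₀ l e)
      ... | no  _    | no  _    = punchIn-injective i₀ l l' e

      sidon : Sidon g
      sidon k l k' l' e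
        with rainbow-samePair sumColoring f rainbow (vertex≢partner k l) (vertex≢partner k' l')
               (trans (partner-colour k l) (trans e (sym (partner-colour k' l'))))
      ... | inj₂ (vk≡pk'l' , pkl≡vk') =
        inj₂ (vertex≡partner⇒≡ {k} {k'} vk≡pk'l' , sym (vertex≡partner⇒≡ {k'} {k} (sym pkl≡vk')))
      ... | inj₁ (vk≡vk' , pkl≡pk'l') with punchIn-injective i₀ k k' vk≡vk'
      ...   | refl = inj₁ (refl , partner-injective {k} pkl≡pk'l')

    avoiding-∞ : (∀ i → zero ≢ f i) → suc (suc p) * suc p ≤ N + suc (suc p) * 2
    avoiding-∞ finite = weakSidon-size g g-injective ⊕-double-injective weakSidon
      where
      g : Fin (suc (suc p)) → Fin N
      g i = punchOut (finite i)

      f≡suc-g : ∀ i → f i ≡ suc (g i)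
      f≡suc-g i = sym (punchIn-punchOut (finite i))

      g-injective : Injective _≡_ _≡_ g
      g-injective {i} {j} e = f-inj (trans (f≡suc-g i) (trans (cong suc e) (sym (f≡suc-g j))))

      col≡⊕ : ∀ i j → sumCol (f i) (f j) ≡ g i ⊕ g j
      col≡⊕ i j = cong₂ sumCol (f≡suc-g i) (f≡suc-g j)

      weakSidon : WeakSidon g
      weakSidon {i} {j} {i'} {j'} i≢j i'≢j' e = rainbow-samePair sumColoring f rainbow i≢j i'≢j'
        (trans (col≡⊕ i j) (trans e (sym (col≡⊕ i' j'))))

  sumColoring-rainbowFree : ∀ {p} → N < suc p * p → N + suc (suc p) * 2 < suc (suc p) * suc p →
                            ¬ RainbowK sumColoring (suc (suc p))
  sumColoring-rainbowFree small-with-∞ small-without-∞ (f , f-inj , rainbow) with any? (λ i → f i ≟ zero)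
  ... | yes (i₀ , fi₀≡∞) = <⇒≱ small-with-∞ (through-∞ f-inj rainbow i₀ fi₀≡∞)
  ... | no  none≡∞       = <⇒≱ small-without-∞ (avoiding-∞ f-inj rainbow (λ i 0≡fi → none≡∞ (i , sym 0≡fi)))

open SumColoring using (sumColoring; sumColoring-balanced; sumColoring-rainbowFree)

pairs-double : ∀ n → 2 * (suc n C 2) ≡ suc n * n
pairs-double zero    = refl
pairs-double (suc n) = begin
  2 * (suc (suc n) C 2)        ≡⟨ cong (2 *_) (nCk+nC[k+1]≡[n+1]C[k+1] (suc n) 1) ⟨
  2 * (suc n C 1 + suc n C 2)  ≡⟨ cong (λ c → 2 * (c + suc n C 2)) (nC1≡n (suc n)) ⟩
  2 * (suc n + suc n C 2)      ≡⟨ *-distribˡ-+ 2 (suc n) (suc n C 2) ⟩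
  2 * suc n + 2 * (suc n C 2)  ≡⟨ cong (2 * suc n +_) (pairs-double n) ⟩
  2 * suc n + suc n * n        ≡⟨ last-step n ⟩
  suc (suc n) * suc n          ∎
  where
  open ≡-Reasoning
  last-step : ∀ n → 2 * suc n + suc n * n ≡ suc (suc n) * suc n
  last-step n = solve (n ∷ [])

pairs-even : ∀ q → q % 4 ≡ 0 ⊎ q % 4 ≡ 1 → Σ ℕ λ h → q C 2 ≡ 2 * h
pairs-even q q%4 with q / 4 | m≡m%n+[m/n]*n q 4
pairs-even q (inj₁ q%4≡0) | zero  | q≡ rewrite q%4≡0 | q≡ = 0 , refl
pairs-even q (inj₁ q%4≡0) | suc i | q≡ rewrite q%4≡0 | q≡ =
  suc i * (3 + i * 4) , *-cancelˡ-≡ _ _ 2 (trans (pairs-double (3 + i * 4)) (solve (i ∷ [])))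
pairs-even q (inj₂ q%4≡1) | j     | q≡ rewrite q%4≡1 | q≡ =
  j * suc (j * 4) , *-cancelˡ-≡ _ _ 2 (trans (pairs-double (j * 4)) (solve (j ∷ [])))

sumColoring-small : ∀ p ℓ → 6 ≤ p → 2 * ℓ ≡ suc (suc p) * suc p →
                    suc ℓ < suc p * p × suc ℓ + suc (suc p) * 2 < suc (suc p) * suc p
sumColoring-small p ℓ 6≤p pairs with m≤n⇒∃[o]m+o≡n 6≤p
... | r , refl = with-∞ , without-∞
  where
  open ≤-Reasoning

  with-∞ : suc ℓ < (7 + r) * (6 + r)
  with-∞ = *-cancelˡ-≤ 2 (begin
    2 * (2 + ℓ)                                    ≡⟨ solve (ℓ ∷ []) ⟩
    4 + 2 * ℓ                                      ≡⟨ cong (4 +_) pairs ⟩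
    4 + (8 + r) * (7 + r)                          ≤⟨ m≤m+n _ (24 + 11 * r + r * r) ⟩
    4 + (8 + r) * (7 + r) + (24 + 11 * r + r * r)  ≡⟨ solve (r ∷ []) ⟩
    2 * ((7 + r) * (6 + r))                        ∎)

  2q+2≤ℓ : 18 + 2 * r ≤ ℓ
  2q+2≤ℓ = *-cancelˡ-≤ 2 (begin
    2 * (18 + 2 * r)                          ≤⟨ m≤m+n _ (20 + 11 * r + r * r) ⟩
    2 * (18 + 2 * r) + (20 + 11 * r + r * r)  ≡⟨ solve (r ∷ []) ⟩
    (8 + r) * (7 + r)                         ≡⟨ pairs ⟨
    2 * ℓ                                     ∎)

  without-∞ : suc ℓ + (8 + r) * 2 < (8 + r) * (7 + r)
  without-∞ = begin
    suc (suc ℓ + (8 + r) * 2)  ≡⟨ solve (ℓ ∷ r ∷ []) ⟩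
    ℓ + (18 + 2 * r)           ≤⟨ +-monoʳ-≤ ℓ 2q+2≤ℓ ⟩
    ℓ + ℓ                      ≡⟨ solve (ℓ ∷ []) ⟩
    2 * ℓ                      ≡⟨ pairs ⟩
    (8 + r) * (7 + r)          ∎

theorem3 : (q : ℕ) → 8 ≤ q → (q % 4 ≡ 0 ⊎ q % 4 ≡ 1) →
    (k : ℕ) → 1 ≤ k →
    Σ (EdgeColoring ((q C 2 + 2) ^ k) (suc (q C 2))) λ c →
      CompletelyBalanced c × ¬ RainbowK c q
theorem3 q@(suc (suc p)) (s≤s (s≤s 6≤p)) q%4 k _ with pairs-even q q%4
... | h , ℓ≡2h rewrite ℓ≡2h | +-comm (2 * h) 2 =
  blowUp-power (sumColoring h) (s≤s (s≤s z≤n)) (sumColoring-balanced h) sumColoring-free k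
  where
  sumColoring-free : ¬ RainbowK (sumColoring h) q
  sumColoring-free = uncurry (sumColoring-rainbowFree h)
    (sumColoring-small p (2 * h) 6≤p (trans (cong (2 *_) (sym ℓ≡2h)) (pairs-double (suc p))))
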